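{- Let $M=(E,\mathcal{I})$ be a matroid and $t$ a positive integer. If there exists a flat $F$ of $M$ such that $|E|-|F|<t\,(r_M(E)-r_M(F))$, then $ar(M,t)=|E|$.
   Context: All matroids have finite ground sets. $r_M(S)$ denotes the rank of $S\subseteq E$. The closure of $S$ is $cl(S)=\{x\in E: r_M(S\cup\{x\})=r_M(S)\}$, and a flat is a set $F$ with $cl(F)=F$. A coloring of $E$ assigns a color to every element of $E$. A rainbow basis is a basis of $M$ whose elements receive pairwise different colors. The anti-Ramsey number $ar(M,t)$ is the maximum number $m$ such that there exists a coloring of $E$ using exactly $m$ colors which contains no $t$ pairwise disjoint rainbow bases. -}

module Defs where

open import Data.Bool using (Bool; true; false; if_then_else_)
open import Data.Nat using (ℕ; zero; suc; _<_; _≤_; _⊔_; _≟_)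
open import Data.Fin using (Fin)
open import Data.Fin.Subset using (Subset; _∈_; _∉_; _⊆_; _∪_; _∩_; ⁅_⁆; ∣_∣; ⊤; ⊥; inside; outside)
open import Data.Fin.Subset.Properties using (_⊆?_)
open import Data.Vec using (Vec; []; _∷_; tabulate; lookup)
open import Data.List using (List; []; _∷_; map; foldr; filter; _++_)
open import Data.Product using (Σ; _×_; ∃; ∃-syntax)
open import Relation.Nullary using (¬_; yes; no)
open import Relation.Nullary.Decidable using (⌊_⌋)
open import Relation.Binary.PropositionalEquality using (_≡_)
open import Function.Definitions using (Surjective)

record Matroid (n : ℕ) : Set where
  field
    indep      : Subset n → Bool
    indep-⊥    : indep ⊥ ≡ true
    hereditary : ∀ (A B : Subset n) → A ⊆ B → indep B ≡ true → indep A ≡ true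
    augment    : ∀ (A B : Subset n) → indep A ≡ true → indep B ≡ true → ∣ A ∣ < ∣ B ∣ →
                 ∃[ x ] (x ∈ B × x ∉ A × indep (A ∪ ⁅ x ⁆) ≡ true)

open Matroid public

allSubsets : (n : ℕ) → List (Subset n)
allSubsets zero    = [] ∷ []
allSubsets (suc n) = map (inside ∷_) (allSubsets n) ++ map (outside ∷_) (allSubsets n)

maximum : List ℕ → ℕ
maximum = foldr _⊔_ 0

rank : ∀ {n} → Matroid n → Subset n → ℕ
rank {n} M S =
  maximum (map ∣_∣ (filter (λ I → I ⊆? S) (filter (λ I → indep M I Data.Bool.≟ true) (allSubsets n))))

closure : ∀ {n} → Matroid n → Subset n → Subset n
closure M S = tabulate (λ x → ⌊ rank M (S ∪ ⁅ x ⁆) ≟ rank M S ⌋)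

IsFlat : ∀ {n} → Matroid n → Subset n → Set
IsFlat M F = closure M F ≡ F

IsBasis : ∀ {n} → Matroid n → Subset n → Set
IsBasis M B = indep M B ≡ true × (∀ x → x ∉ B → indep M (B ∪ ⁅ x ⁆) ≡ false)

-- A coloring of E using exactly m colors: a surjection E → Fin m.
Coloring : ℕ → ℕ → Set
Coloring n m = Σ (Fin n → Fin m) (λ c → Surjective _≡_ _≡_ c)

IsRainbowBasis : ∀ {n m} → Matroid n → (Fin n → Fin m) → Subset n → Set
IsRainbowBasis M c B = IsBasis M B × (∀ x y → x ∈ B → y ∈ B → c x ≡ c y → x ≡ y)

HasDisjointRainbowBases : ∀ {n m} → Matroid n → (Fin n → Fin m) → ℕ → Set
HasDisjointRainbowBases {n} M c t =
  Σ (Vec (Subset n) t) λ Bs →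
    (∀ i → IsRainbowBasis M c (lookup Bs i)) ×
    (∀ i j → ¬ i ≡ j → lookup Bs i ∩ lookup Bs j ≡ ⊥)

Attainable : ∀ {n} → Matroid n → ℕ → ℕ → Set
Attainable {n} M t m = Σ (Coloring n m) λ c → ¬ HasDisjointRainbowBases M (Σ.proj₁ c) t

IsAntiRamseyNumber : ∀ {n} → Matroid n → ℕ → ℕ → Set
IsAntiRamseyNumber M t m = Attainable M t m × (∀ m' → Attainable M t m' → m' ≤ m)

-- Give every element its own color, so rainbow bases are just bases. Each of t
-- disjoint bases B has |B ∖ F| ≥ r(E) − r(F), because B ∩ F is independent inside F;
-- so t disjoint bases need t (r(E) − r(F)) ≤ |E ∖ F| elements outside F, which the
-- hypothesis forbids. No coloring uses more than |E| colors.
module Submission where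

open import Defs
open import Data.Nat using (ℕ; _<_; _*_; _∸_)
open import Data.Fin.Subset using (Subset; ∣_∣; ⊤)
open import Data.Product using (∃-syntax; _×_)

open import Data.Bool using (true)
import Data.Bool as Bool
open import Data.Fin using (Fin; zero; suc)
open import Data.Fin.Properties using (injective⇒≤; suc-injective)
open import Data.Fin.Subset using (_∈_; _⊆_; _∩_; ∁; inside; outside)
import Data.Fin.Subset as Subset
open import Data.Fin.Subset.Properties
  using (_⊆?_; ∣⊤∣≡n; ∣∁p∣≡n∸∣p∣; p⊆q⇒∣p∣≤∣q∣; p∩q⊆p; p∩q⊆q; x∈p∩q⁺; x∈p∩q⁻; ∉⊥; x∉p⇒x∈∁p; ∩-comm)
open import Data.List using (List; map)
import Data.List as List
open import Data.List.Membership.Propositional using () renaming (_∈_ to _∈ˡ_)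
open import Data.List.Membership.Propositional.Properties using (∈-map⁺; ∈-++⁺ˡ; ∈-++⁺ʳ; ∈-filter⁺)
open import Data.List.Properties using (foldr-preservesᵇ)
open import Data.List.Relation.Unary.All using (All)
open import Data.List.Relation.Unary.All.Properties using (all-filter; filter⁺; map⁺)
import Data.List.Relation.Unary.All as All
open import Data.List.Relation.Unary.Any using (here; there)
open import Data.Nat using (zero; suc; _+_; _≤_; z≤n)
open import Data.Nat.Properties
  using (m≤m⊔n; m≤n⊔m; ≤-trans; ⊔-lub; _≤?_; ≰⇒>; +-suc; +-mono-≤; +-monoˡ-≤; m≤n+o⇒m∸n≤o; <⇒≱; module ≤-Reasoning)
open import Data.Product using (_,_; proj₁; proj₂)
open import Data.Vec using (Vec; []; _∷_; lookup)
open import Function.Definitions using (Injective; Surjective)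
open import Relation.Nullary using (¬_; yes; no)
open import Relation.Binary.PropositionalEquality using (_≡_; refl; sym; trans; cong; subst)

private
  variable
    n m t : ℕ

≤-maximum : ∀ {x} (xs : List ℕ) → x ∈ˡ xs → x ≤ maximum xs
≤-maximum (y List.∷ ys) (here refl) = m≤m⊔n y (maximum ys)
≤-maximum (y List.∷ ys) (there x∈ys) = ≤-trans (≤-maximum ys x∈ys) (m≤n⊔m y (maximum ys))

maximum-≤ : ∀ {k} (xs : List ℕ) → All (_≤ k) xs → maximum xs ≤ k
maximum-≤ _ = foldr-preservesᵇ ⊔-lub z≤n

∈-allSubsets : ∀ n (I : Subset n) → I ∈ˡ allSubsets n
∈-allSubsets zero    []            = here refl
∈-allSubsets (suc n) (inside ∷ I)  = ∈-++⁺ˡ (∈-map⁺ (inside ∷_) (∈-allSubsets n I))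
∈-allSubsets (suc n) (outside ∷ I) =
  ∈-++⁺ʳ (map (inside ∷_) (allSubsets n)) (∈-map⁺ (outside ∷_) (∈-allSubsets n I))

module _ (M : Matroid n) where

  indep⇒∣I∣≤rank : ∀ {I S} → indep M I ≡ true → I ⊆ S → ∣ I ∣ ≤ rank M S
  indep⇒∣I∣≤rank {I} {S} I-indep I⊆S = ≤-maximum _
    (∈-map⁺ ∣_∣ (∈-filter⁺ (_⊆? S) (∈-filter⁺ (λ J → indep M J Bool.≟ true) (∈-allSubsets n I) I-indep) I⊆S))

  -- A larger independent set would augment B, contradicting maximality.
  indep⇒∣I∣≤∣basis∣ : ∀ {B I} → IsBasis M B → indep M I ≡ true → ∣ I ∣ ≤ ∣ B ∣
  indep⇒∣I∣≤∣basis∣ {B} {I} (B-indep , B-maximal) I-indep with ∣ I ∣ ≤? ∣ B ∣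
  ... | yes ∣I∣≤∣B∣ = ∣I∣≤∣B∣
  ... | no ∣I∣≰∣B∣ with augment M B I B-indep I-indep (≰⇒> ∣I∣≰∣B∣)
  ...   | x , _ , x∉B , B+x-indep with trans (sym B+x-indep) (B-maximal x x∉B)
  ...     | ()

  rank⊤≤∣basis∣ : ∀ {B} → IsBasis M B → rank M ⊤ ≤ ∣ B ∣
  rank⊤≤∣basis∣ B-basis = maximum-≤ _
    (map⁺ (filter⁺ (_⊆? ⊤) (All.map (indep⇒∣I∣≤∣basis∣ B-basis) (all-filter _ (allSubsets n)))))

∣p∣≡∣p∩q∣+∣p∩∁q∣ : (p q : Subset n) → ∣ p ∣ ≡ ∣ p ∩ q ∣ + ∣ p ∩ ∁ q ∣
∣p∣≡∣p∩q∣+∣p∩∁q∣ []            []            = refl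
∣p∣≡∣p∩q∣+∣p∩∁q∣ (outside ∷ p) (_ ∷ q)       = ∣p∣≡∣p∩q∣+∣p∩∁q∣ p q
∣p∣≡∣p∩q∣+∣p∩∁q∣ (inside ∷ p)  (inside ∷ q)  = cong suc (∣p∣≡∣p∩q∣+∣p∩∁q∣ p q)
∣p∣≡∣p∩q∣+∣p∩∁q∣ (inside ∷ p)  (outside ∷ q) =
  trans (cong suc (∣p∣≡∣p∩q∣+∣p∩∁q∣ p q)) (sym (+-suc ∣ p ∩ q ∣ ∣ p ∩ ∁ q ∣))

p∩q≡⊥⇒p∩s⊆p∩s∖q : ∀ {p q : Subset n} (s : Subset n) → p ∩ q ≡ Subset.⊥ → p ∩ s ⊆ p ∩ (s ∩ ∁ q)
p∩q≡⊥⇒p∩s⊆p∩s∖q {p = p} {q} s p∩q≡⊥ {x} x∈p∩s =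
  x∈p∩q⁺ (x∈p , x∈p∩q⁺ (x∈s , x∉p⇒x∈∁p (λ x∈q → ∉⊥ (subst (x ∈_) p∩q≡⊥ (x∈p∩q⁺ (x∈p , x∈q))))))
  where
  x∈p = proj₁ (x∈p∩q⁻ p s x∈p∩s)
  x∈s = proj₂ (x∈p∩q⁻ p s x∈p∩s)

PairwiseDisjoint : Vec (Subset n) t → Set
PairwiseDisjoint bs = ∀ i j → ¬ i ≡ j → lookup bs i ∩ lookup bs j ≡ Subset.⊥

-- Induction on the family: the first member takes its d elements out of s, the others live in s ∖ b.
disjoint-*-≤ : ∀ {d} (s : Subset n) (bs : Vec (Subset n) t) → PairwiseDisjoint bs →
               (∀ i → d ≤ ∣ lookup bs i ∩ s ∣) → t * d ≤ ∣ s ∣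
disjoint-*-≤ s []       _        _     = z≤n
disjoint-*-≤ {d = d} s (b ∷ bs) disjoint large = begin
  d + _                       ≤⟨ +-mono-≤ (subst (d ≤_) (cong ∣_∣ (∩-comm b s)) (large zero)) tail-bound ⟩
  ∣ s ∩ b ∣ + ∣ s ∩ ∁ b ∣     ≡⟨ sym (∣p∣≡∣p∩q∣+∣p∩∁q∣ s b) ⟩
  ∣ s ∣                       ∎
  where
  open ≤-Reasoning
  tail-bound = disjoint-*-≤ (s ∩ ∁ b) bs
    (λ i j i≢j → disjoint (suc i) (suc j) (λ si≡sj → i≢j (suc-injective si≡sj)))
    (λ i → ≤-trans (large (suc i))
      (p⊆q⇒∣p∣≤∣q∣ (p∩q≡⊥⇒p∩s⊆p∩s∖q s (disjoint (suc i) zero λ ()))))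

basis-meets-∁ : (M : Matroid n) (F : Subset n) {B : Subset n} → IsBasis M B →
                rank M ⊤ ∸ rank M F ≤ ∣ B ∩ ∁ F ∣
basis-meets-∁ M F {B} B-basis = m≤n+o⇒m∸n≤o (rank M ⊤) (rank M F) (begin
  rank M ⊤                  ≤⟨ rank⊤≤∣basis∣ M B-basis ⟩
  ∣ B ∣                     ≡⟨ ∣p∣≡∣p∩q∣+∣p∩∁q∣ B F ⟩
  ∣ B ∩ F ∣ + ∣ B ∩ ∁ F ∣   ≤⟨ +-monoˡ-≤ _ (indep⇒∣I∣≤rank M B∩F-indep (p∩q⊆q B F)) ⟩
  rank M F + ∣ B ∩ ∁ F ∣    ∎)
  where
  open ≤-Reasoning
  B∩F-indep = hereditary M (B ∩ F) B (p∩q⊆p B F) (proj₁ B-basis)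

disjointBases-bound : (M : Matroid n) (F : Subset n) (Bs : Vec (Subset n) t) →
                      (∀ i → IsBasis M (lookup Bs i)) → PairwiseDisjoint Bs →
                      t * (rank M ⊤ ∸ rank M F) ≤ n ∸ ∣ F ∣
disjointBases-bound {t = t} M F Bs bases disjoint = begin
  t * (rank M ⊤ ∸ rank M F)   ≤⟨ disjoint-*-≤ (∁ F) Bs disjoint (λ i → basis-meets-∁ M F (bases i)) ⟩
  ∣ ∁ F ∣                     ≡⟨ ∣∁p∣≡n∸∣p∣ F ⟩
  _ ∸ ∣ F ∣                   ∎
  where open ≤-Reasoning

surjective⇒≤ : {c : Fin n → Fin m} → Surjective _≡_ _≡_ c → m ≤ n
surjective⇒≤ {c = c} surj = injective⇒≤ section-injective
  where
  section-injective : Injective _≡_ _≡_ (λ y → proj₁ (surj y))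
  section-injective {y} {y′} eq =
    trans (sym (proj₂ (surj y) refl)) (trans (cong c eq) (proj₂ (surj y′) refl))

rainbowColoring : Coloring n ∣ ⊤ {n} ∣
rainbowColoring {n} = subst (Coloring n) (sym (∣⊤∣≡n n)) ((λ x → x) , λ y → y , λ z≡y → z≡y)

corollary7 : ∀ {n : ℕ} (M : Matroid n) (t : ℕ) → 0 < t →
    ∃[ F ] (IsFlat M F × ∣ ⊤ {n} ∣ ∸ ∣ F ∣ < t * (rank M ⊤ ∸ rank M F)) →
    IsAntiRamseyNumber M t ∣ ⊤ {n} ∣
corollary7 {n} M t _ (F , _ , deficient) = (rainbowColoring , noDisjointBases) , atMost∣E∣
  where
  noDisjointBases : ¬ HasDisjointRainbowBases M (proj₁ rainbowColoring) t
  noDisjointBases (Bs , rainbow , disjoint) = <⇒≱ deficient (begin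
    t * (rank M ⊤ ∸ rank M F)   ≤⟨ disjointBases-bound M F Bs (λ i → proj₁ (rainbow i)) disjoint ⟩
    n ∸ ∣ F ∣                   ≡⟨ cong (_∸ ∣ F ∣) (sym (∣⊤∣≡n n)) ⟩
    ∣ ⊤ {n} ∣ ∸ ∣ F ∣           ∎)
    where open ≤-Reasoning
  atMost∣E∣ : ∀ m → Attainable M t m → m ≤ ∣ ⊤ {n} ∣
  atMost∣E∣ m ((_ , surj) , _) = subst (m ≤_) (sym (∣⊤∣≡n n)) (surjective⇒≤ surj)
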